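{- Let $G$ be a graph with domination number $\gamma$ such that $\mathrm{Sp}^p_\alpha(G)=\{a_1,a_2,\dots,a_t\}$ with $1=a_1<a_2<\cdots<a_t=\gamma$ and $t>1$. Then there exist $t-1$ rational numbers $\alpha_1<\alpha_2<\cdots<\alpha_{t-1}$ in $(0,1)\cap\mathbb{Q}$ such that (1) $\mathrm{pd}_\alpha(G)=1$ for all $\alpha\in(0,\alpha_1]$; (2) for each $i\in\{1,\dots,t-2\}$ and all $\alpha\in(\alpha_i,\alpha_{i+1}]$, $\mathrm{pd}_\alpha(G)=a_{i+1}$; (3) $\mathrm{pd}_\alpha(G)=\gamma$ for all $\alpha\in(\alpha_{t-1},1]$.
   Context: All graphs are finite and simple. For a graph $G=(V,E)$ and $S\subseteq V$, $N[S]$ denotes the closed neighbourhood of $S$. For $0<\alpha\le 1$, a set $S\subseteq V$ is an $\alpha$-partial dominating set if $|N[S]|\ge \alpha|V|$; $\mathrm{pd}_\alpha(G)$ is the minimum size of an $\alpha$-partial dominating set. The $\alpha$-partial domination spectrum is $\mathrm{Sp}^p_\alpha(G)=\{\mathrm{pd}_\alpha(G):\alpha\in(0,1]\}$, the set of distinct values taken by $\mathrm{pd}_\alpha(G)$.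
   Formalization: The parameter α of $\mathrm{pd}_\alpha(G)$ ranges over the rationals in (0,1] instead of all real numbers in (0,1], so the spectrum $\mathrm{Sp}^p_\alpha(G)$ is also taken over rational α. -}

module Defs where

open import Data.Nat using (ℕ; zero; suc)
open import Data.Bool using (Bool; true; false; _∨_; _∧_)
open import Data.Fin using (Fin)
import Data.Fin as F
open import Data.Vec using (lookup; tabulate)
open import Data.Fin.Subset using (Subset; ∣_∣; ⊤)
open import Data.Integer using (+_)
open import Data.Rational using (ℚ; _/_; _*_; _≤_)
open import Data.Product using (Σ; _×_)
open import Relation.Binary.PropositionalEquality using (_≡_)

record Graph (n : ℕ) : Set where
  field
    adj    : Fin n → Fin n → Bool
    sym    : ∀ u v → adj u v ≡ adj v u
    irrefl : ∀ v → adj v v ≡ false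
open Graph public

anyᶠ : ∀ {n} → (Fin n → Bool) → Bool
anyᶠ {zero}  f = false
anyᶠ {suc n} f = f F.zero ∨ anyᶠ (λ i → f (F.suc i))

N[_]_ : ∀ {n} → Graph n → Subset n → Subset n
N[ G ] S = tabulate (λ v → lookup S v ∨ anyᶠ (λ u → lookup S u ∧ adj G u v))

ℕ→ℚ : ℕ → ℚ
ℕ→ℚ k = + k / 1

IsPartialDom : ∀ {n} → Graph n → ℚ → Subset n → Set
IsPartialDom {n} G α S = α * ℕ→ℚ n ≤ ℕ→ℚ ∣ N[ G ] S ∣

IsPd : ∀ {n} → Graph n → ℚ → ℕ → Set
IsPd {n} G α k =
  Σ (Subset n) (λ S → ∣ S ∣ ≡ k × IsPartialDom G α S)
  × (∀ (S : Subset n) → IsPartialDom G α S → k Data.Nat.≤ ∣ S ∣)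

IsDominating : ∀ {n} → Graph n → Subset n → Set
IsDominating G S = N[ G ] S ≡ ⊤

IsDomNumber : ∀ {n} → Graph n → ℕ → Set
IsDomNumber {n} G k =
  Σ (Subset n) (λ S → ∣ S ∣ ≡ k × IsDominating G S)
  × (∀ (S : Subset n) → IsDominating G S → k Data.Nat.≤ ∣ S ∣)

InSpectrum : ∀ {n} → Graph n → ℕ → Set
InSpectrum G k = Σ ℚ (λ α → (ℕ→ℚ 0 Data.Rational.< α) × (α ≤ ℕ→ℚ 1) × IsPd G α k)

module Submission where

open import Defs
open import Data.Nat using (ℕ; suc; _∸_) renaming (_≤_ to _≤ℕ_; _<_ to _<ℕ_)
open import Data.Rational using (ℚ; _<_; _≤_)
open import Data.Product using (Σ; _×_)
open import Relation.Binary.PropositionalEquality using (_≡_)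
open import Function.Bundles using (_⇔_)

open import Data.Nat as ℕ using (zero; z≤n; s≤s)
import Data.Nat.Properties as ℕP
open import Data.Integer as ℤ using (+_)
import Data.Integer.Properties as ℤP
import Data.Nat.Coprimality as Coprime
open import Data.Rational as ℚ using (mkℚ; *≤*; *<*; _*_; _÷_; Positive; NonNegative)
import Data.Rational.Properties as ℚP
open import Data.Bool using (true; false)
open import Data.Vec using ([]; _∷_)
open import Data.Fin.Subset using (Subset; ∣_∣; ⊥)
import Data.Fin.Subset.Properties as SubsetP
open import Data.Product using (_,_; proj₁; proj₂)
open import Data.Empty using (⊥-elim)
open import Data.Sum using (inj₁; inj₂)
open import Relation.Nullary using (¬_; yes; no)
import Relation.Nullary.Decidable as Dec
open import Relation.Unary using (Decidable)
open import Relation.Binary.PropositionalEquality using (refl; trans; cong; subst; subst₂) renaming (sym to ≡-sym)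
open import Relation.Binary using (tri<; tri≈; tri>)
open import Function using (_∘_; _$_)
open import Function.Bundles using (Equivalence)

-- For k ∈ ℕ let F(k) be the largest number of vertices
-- dominated by a set of at most k vertices.  A set S is α-partial
-- dominating iff α·n ≤ |N[S]|, so pd_α(G) is the least k with α·n ≤ F(k);
-- F is monotone, F(k) < n for k < γ and F(γ) = n.  The thresholds are
--   α_i = F(a_i) / n.
-- They lie in (0,1) and increase strictly, because a_{i+1} = pd_β for some
-- β and then F(a_i) < β·n ≤ F(a_{i+1}).  For β ∈ (α_i, α_{i+1}] we have
-- F(a_i) < β·n ≤ F(a_{i+1}), so pd_β lies in (a_i, a_{i+1}]; being in the
-- spectrum, it equals some a_j, and strict monotonicity of a forces j = i+1.

ℕ→ℚ-canonical : ∀ k → ℕ→ℚ k ≡ mkℚ (+ k) 0 (Coprime.sym (Coprime.1-coprimeTo k))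
ℕ→ℚ-canonical k = ℚP.normalize-coprime (Coprime.sym (Coprime.1-coprimeTo k))

ℕ→ℚ-mono-≤ : ∀ {m k} → m ≤ℕ k → ℕ→ℚ m ≤ ℕ→ℚ k
ℕ→ℚ-mono-≤ {m} {k} m≤k rewrite ℕ→ℚ-canonical m | ℕ→ℚ-canonical k =
  *≤* (subst₂ ℤ._≤_ (≡-sym (ℤP.*-identityʳ (+ m))) (≡-sym (ℤP.*-identityʳ (+ k))) (ℤ.+≤+ m≤k))

ℕ→ℚ-mono-< : ∀ {m k} → m <ℕ k → ℕ→ℚ m < ℕ→ℚ k
ℕ→ℚ-mono-< {m} {k} m<k rewrite ℕ→ℚ-canonical m | ℕ→ℚ-canonical k =
  *<* (subst₂ ℤ._<_ (≡-sym (ℤP.*-identityʳ (+ m))) (≡-sym (ℤP.*-identityʳ (+ k))) (ℤ.+<+ m<k))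

ℕ→ℚ-one : ℕ→ℚ 1 ≡ ℚ.1ℚ
ℕ→ℚ-one = refl

module Scaling (N : ℚ) .{{N-pos : Positive N}} where

  instance
    N≢0 : ℚ.NonZero N
    N≢0 = ℚP.pos⇒nonZero N

    N≥0 : NonNegative N
    N≥0 = ℚP.pos⇒nonNeg N

  -- Abstract: only the cancellation law below is ever needed, and unfolding
  -- rational division on symbolic arguments is prohibitively expensive.
  abstract
    _÷N : ℚ → ℚ
    x ÷N = x ÷ N

    ÷N-*N : ∀ x → (x ÷N) * N ≡ x
    ÷N-*N x = trans (ℚP.*-assoc x (ℚ.1/ N) N)
                    (trans (cong (x *_) (ℚP.*-inverseˡ N)) (ℚP.*-identityʳ x))

  1*N≡N : ℕ→ℚ 1 * N ≡ N
  1*N≡N = trans (cong (_* N) ℕ→ℚ-one) (ℚP.*-identityˡ N)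

  ≤÷N⇒*N≤ : ∀ β x → β ≤ x ÷N → β * N ≤ x
  ≤÷N⇒*N≤ β x h = subst (β * N ≤_) (÷N-*N x) (ℚP.*-monoʳ-≤-nonNeg N h)

  *N≤⇒≤÷N : ∀ β x → β * N ≤ x → β ≤ x ÷N
  *N≤⇒≤÷N β x h = ℚP.*-cancelʳ-≤-pos N (subst (β * N ≤_) (≡-sym (÷N-*N x)) h)

  ÷N<⇒<*N : ∀ β x → x ÷N < β → x < β * N
  ÷N<⇒<*N β x h = subst (_< β * N) (÷N-*N x) (ℚP.*-monoˡ-<-pos N h)

  <*N⇒÷N< : ∀ β x → x < β * N → x ÷N < β
  <*N⇒÷N< β x h = ℚP.*-cancelʳ-<-nonNeg N (subst (_< β * N) (≡-sym (÷N-*N x)) h)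

least : {P : ℕ → Set} → Decidable P → ∀ k → P k
      → Σ ℕ (λ m → P m × m ≤ℕ k × (∀ j → j <ℕ m → ¬ P j))
least P? zero pk = 0 , pk , z≤n , λ _ ()
least P? (suc k) pk with P? 0
... | yes p₀ = 0 , p₀ , z≤n , λ _ ()
... | no ¬p₀ with least (P? ∘ suc) k pk
...   | m , pm , m≤k , below =
  suc m , pm , s≤s m≤k , λ { zero _ → ¬p₀ ; (suc j) (s≤s j<m) → below j j<m }

maximiser : ∀ {n} (w : Subset n → ℕ) → Σ (Subset n) (λ S → ∀ T → w T ≤ℕ w S)
maximiser {zero} w = [] , λ { [] → ℕP.≤-refl }
maximiser {suc n} w
  with maximiser (w ∘ (true ∷_)) | maximiser (w ∘ (false ∷_))
... | S , S-max | T , T-max with w (true ∷ S) ℕ.≤? w (false ∷ T)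
...   | yes S≤T = false ∷ T , λ { (true ∷ U) → ℕP.≤-trans (S-max U) S≤T
                                ; (false ∷ U) → T-max U }
...   | no S≰T = true ∷ S , λ { (true ∷ U) → S-max U
                              ; (false ∷ U) → ℕP.≤-trans (T-max U) (ℕP.<⇒≤ (ℕP.≰⇒> S≰T)) }

-- Pinching: in a sequence strictly increasing on [1,t], an index j with
-- a_i < a_j ≤ a_{i+1} must be i+1 (for i = 0 only the upper bound is given).

IncreasingUpTo : ℕ → (ℕ → ℕ) → Set
IncreasingUpTo t a = ∀ i j → 1 ≤ℕ i → i <ℕ j → j ≤ℕ t → a i <ℕ a j

pinched-index : ∀ {t} (a : ℕ → ℕ) → IncreasingUpTo t a → ∀ {i j}
  → 1 ≤ℕ j → j ≤ℕ t → suc i ≤ℕ t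
  → (1 ≤ℕ i → a i <ℕ a j) → a j ≤ℕ a (suc i) → j ≡ suc i
pinched-index {t} a a-mono {i} {j} 1≤j j≤t i<t above below with ℕP.<-cmp j (suc i)
... | tri≈ _ j≡ _ = j≡
... | tri> _ _ j>i+1 = ⊥-elim (ℕP.<⇒≱ (a-mono (suc i) j (s≤s z≤n) j>i+1 j≤t) below)
... | tri< j≤i _ _ with ℕP.m≤n⇒m<n∨m≡n (ℕP.≤-pred j≤i)
...   | inj₁ j<i = ⊥-elim (ℕP.<-asym (a-mono j i 1≤j j<i (ℕP.≤-trans (ℕP.n≤1+n i) i<t))
                                            (above (ℕP.≤-trans 1≤j (ℕP.<⇒≤ j<i))))
...   | inj₂ refl = ⊥-elim (ℕP.<-irrefl refl (above 1≤j))

spectrum-bounded : ∀ {n} (G : Graph n) {k} → InSpectrum G k → k ≤ℕ n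
spectrum-bounded G (_ , _ , _ , (S , |S|≡k , _) , _) =
  subst (_≤ℕ _) |S|≡k (SubsetP.∣p∣≤n S)

module Coverage {n : ℕ} (G : Graph n) where

  cover : Subset n → ℕ
  cover S = ∣ N[ G ] S ∣

  -- S if it has at most k elements, ∅ otherwise; so every set can be
  -- made an admissible candidate of size ≤ k without changing small sets.
  truncate : ℕ → Subset n → Subset n
  truncate k S with ∣ S ∣ ℕ.≤? k
  ... | yes _ = S
  ... | no _  = ⊥

  truncate-size : ∀ k S → ∣ truncate k S ∣ ≤ℕ k
  truncate-size k S with ∣ S ∣ ℕ.≤? k
  ... | yes |S|≤k = |S|≤k
  ... | no _      = subst (_≤ℕ k) (≡-sym (SubsetP.∣⊥∣≡0 n)) z≤n

  truncate-small : ∀ k S → ∣ S ∣ ≤ℕ k → truncate k S ≡ S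
  truncate-small k S |S|≤k with ∣ S ∣ ℕ.≤? k
  ... | yes _    = refl
  ... | no |S|≰k = ⊥-elim (|S|≰k |S|≤k)

  -- best k: a set of at most k vertices dominating as many vertices as possible.
  -- Abstract, so that type checking never unfolds the exhaustive search.
  abstract
    best : ℕ → Subset n
    best k = truncate k (proj₁ (maximiser (cover ∘ truncate k)))

    best-size : ∀ k → ∣ best k ∣ ≤ℕ k
    best-size k = truncate-size k (proj₁ (maximiser (cover ∘ truncate k)))

    best-max : ∀ k S → ∣ S ∣ ≤ℕ k → cover S ≤ℕ cover (best k)
    best-max k S |S|≤k = subst (λ X → cover X ≤ℕ cover (best k)) (truncate-small k S |S|≤k)
                               (proj₂ (maximiser (cover ∘ truncate k)) S)

  maxCover : ℕ → ℕ
  maxCover k = cover (best k)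

  maxCover-mono : ∀ {j k} → j ≤ℕ k → maxCover j ≤ℕ maxCover k
  maxCover-mono {j} {k} j≤k = best-max k (best j) (ℕP.≤-trans (best-size j) j≤k)

  -- Reaches β k : some set of k vertices is β-partial dominating,
  -- i.e. β·n ≤ F(k).  A record, so that β and k can be inferred from it.
  record Reaches (β : ℚ) (k : ℕ) : Set where
    constructor reaches
    field
      best-dominates : IsPartialDom G β (best k)
  open Reaches public

  reaches? : ∀ β → Decidable (Reaches β)
  reaches? β k = Dec.map′ reaches best-dominates (β * ℕ→ℚ n ℚP.≤? ℕ→ℚ (maxCover k))

  reaches-mono : ∀ {β j k} → j ≤ℕ k → Reaches β j → Reaches β k
  reaches-mono j≤k (reaches r) = reaches (ℚP.≤-trans r (ℕ→ℚ-mono-≤ (maxCover-mono j≤k)))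

  partialDom⇒reaches : ∀ {β} S → IsPartialDom G β S → Reaches β ∣ S ∣
  partialDom⇒reaches S pS = reaches (ℚP.≤-trans pS (ℕ→ℚ-mono-≤ (best-max ∣ S ∣ S ℕP.≤-refl)))

  least-reach⇒pd : ∀ {β m} → Reaches β m → (∀ j → j <ℕ m → ¬ Reaches β j) → IsPd G β m
  least-reach⇒pd {β} {m} (reaches rm) below = (best m , size-best , rm) , minimal
    where
      minimal : ∀ S → IsPartialDom G β S → m ≤ℕ ∣ S ∣
      minimal S pS = ℕP.≮⇒≥ (λ |S|<m → below _ |S|<m (partialDom⇒reaches S pS))

      size-best : ∣ best m ∣ ≡ m
      size-best = ℕP.≤-antisym (best-size m) (minimal (best m) rm)

  pd⇒least-reach : ∀ β {m} → IsPd G β m → Reaches β m × (∀ j → j <ℕ m → ¬ Reaches β j)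
  pd⇒least-reach β ((S , |S|≡m , pS) , minimal) =
    subst (Reaches β) |S|≡m (partialDom⇒reaches S pS) ,
    λ j j<m (reaches rj) → ℕP.<⇒≱ j<m (ℕP.≤-trans (minimal (best j) rj) (best-size j))

  pd-exists : ∀ {β k} → Reaches β k → Σ ℕ (λ m → IsPd G β m × m ≤ℕ k)
  pd-exists {β} {k} rk =
    let m , rm , m≤k , below = least (reaches? β) k rk
    in m , least-reach⇒pd rm below , m≤k

  reaches-γ : ∀ {γ β} → IsDomNumber G γ → β ≤ ℕ→ℚ 1 → Reaches β γ
  reaches-γ {γ} {β} ((S , |S|≡γ , S-dom) , _) β≤1 = reaches $
    ℚP.≤-trans (subst (β * ℕ→ℚ n ≤_) (ℚP.*-identityˡ (ℕ→ℚ n)) β*n≤n)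
               (ℕ→ℚ-mono-≤ (subst (_≤ℕ maxCover γ) cover-S (best-max γ S (ℕP.≤-reflexive |S|≡γ))))
    where
      instance
        n≥0 : NonNegative (ℕ→ℚ n)
        n≥0 = ℚP.normalize-nonNeg n 1

      β*n≤n : β * ℕ→ℚ n ≤ ℕ→ℚ 1 * ℕ→ℚ n
      β*n≤n = ℚP.*-monoʳ-≤-nonNeg (ℕ→ℚ n) β≤1

      cover-S : cover S ≡ n
      cover-S = trans (cong ∣_∣ S-dom) (SubsetP.∣⊤∣≡n n)

  maxCover<n : ∀ {γ k} → IsDomNumber G γ → k <ℕ γ → maxCover k <ℕ n
  maxCover<n {γ} {k} (_ , γ-min) k<γ = ℕP.≰⇒> λ n≤F →
    let best-dom : IsDominating G (best k)
        best-dom = SubsetP.∣p∣≡n⇒p≡⊤ (ℕP.≤-antisym (SubsetP.∣p∣≤n (N[ G ] best k)) n≤F)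
    in ℕP.<⇒≱ k<γ (ℕP.≤-trans (γ-min (best k) best-dom) (best-size k))

module Thresholds {n : ℕ} .{{_ : ℕ.NonZero n}} (G : Graph n) (γ t : ℕ) (a : ℕ → ℕ)
  (dom : IsDomNumber G γ) (a-last : a t ≡ γ) (a-mono : IncreasingUpTo t a)
  (spec : ∀ k → InSpectrum G k ⇔ Σ ℕ (λ i → 1 ≤ℕ i × i ≤ℕ t × a i ≡ k)) where

  open Coverage G

  instance
    n-pos : Positive (ℕ→ℚ n)
    n-pos = ℚP.normalize-pos n 1

  open Scaling (ℕ→ℚ n)

  Fa : ℕ → ℚ
  Fa i = ℕ→ℚ (maxCover (a i))

  α : ℕ → ℚ
  α i = Fa i ÷N

  reaches-below : ∀ {β k} → β ≤ α k → Reaches β (a k)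
  reaches-below {β} {k} β≤α = reaches (≤÷N⇒*N≤ β (Fa k) β≤α)

  misses-above : ∀ {β k} → α k < β → ¬ Reaches β (a k)
  misses-above {β} {k} α<β (reaches r) = ℚP.<-irrefl refl (ℚP.<-≤-trans (÷N<⇒<*N β (Fa k) α<β) r)

  a-in-spectrum : ∀ {i} → 1 ≤ℕ i → i ≤ℕ t → InSpectrum G (a i)
  a-in-spectrum {i} 1≤i i≤t = Equivalence.from (spec (a i)) (i , 1≤i , i≤t , refl)

  α-pos : ∀ {i} → 1 ≤ℕ i → i ≤ℕ t → ℕ→ℚ 0 < α i
  α-pos {i} 1≤i i≤t = below-some-β (a-in-spectrum 1≤i i≤t)
    where
      below-some-β : InSpectrum G (a i) → ℕ→ℚ 0 < α i
      below-some-β (β , 0<β , _ , pd) =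
        ℚP.<-≤-trans 0<β (*N≤⇒≤÷N β (Fa i) (best-dominates (proj₁ (pd⇒least-reach β pd))))

  α<1 : ∀ {i} → 1 ≤ℕ i → i <ℕ t → α i < ℕ→ℚ 1
  α<1 {i} 1≤i i<t = <*N⇒÷N< (ℕ→ℚ 1) (Fa i) (subst (Fa i <_) (≡-sym (1*N≡N))
    (ℕ→ℚ-mono-< (maxCover<n dom (subst (a i <ℕ_) a-last (a-mono i t 1≤i i<t ℕP.≤-refl)))))

  -- a_{i+1} = pd_β for some β, and then α_i < β ≤ α_{i+1}.
  α-increasing : ∀ {i} → 1 ≤ℕ i → suc i ≤ℕ t → α i < α (suc i)
  α-increasing {i} 1≤i i<t = straddled (a-in-spectrum (s≤s z≤n) i<t)
    where
      straddled : InSpectrum G (a (suc i)) → α i < α (suc i)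
      straddled (β , _ , _ , pd) =
        ℚP.<-≤-trans (<*N⇒÷N< β (Fa i) (ℚP.≰⇒> (misses-a-i ∘ reaches)))
                     (*N≤⇒≤÷N β (Fa (suc i)) (best-dominates (proj₁ (pd⇒least-reach β pd))))
        where
          misses-a-i : ¬ Reaches β (a i)
          misses-a-i = proj₂ (pd⇒least-reach β pd) (a i) (a-mono i (suc i) 1≤i ℕP.≤-refl i<t)

  pd-between : ∀ {β i} → suc i ≤ℕ t → ℕ→ℚ 0 < β → β ≤ ℕ→ℚ 1
    → Reaches β (a (suc i)) → (1 ≤ℕ i → ¬ Reaches β (a i)) → IsPd G β (a (suc i))
  pd-between {β} {i} i<t 0<β β≤1 reach miss =
    let m , pd , m≤ = pd-exists reach
    in identify pd m≤ (Equivalence.to (spec m) (β , 0<β , β≤1 , pd))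
    where
      -- pd_β is in the spectrum, so it is some a_j, pinched between a_i and a_{i+1}.
      identify : ∀ {m} → IsPd G β m → m ≤ℕ a (suc i)
               → Σ ℕ (λ j → 1 ≤ℕ j × j ≤ℕ t × a j ≡ m) → IsPd G β (a (suc i))
      identify pd m≤ (j , 1≤j , j≤t , refl) =
        subst (IsPd G β ∘ a) (pinched-index a a-mono 1≤j j≤t i<t above m≤) pd
        where
          above : 1 ≤ℕ i → a i <ℕ a j
          above 1≤i = ℕP.≰⇒> (λ aj≤ai → miss 1≤i (reaches-mono aj≤ai (proj₁ (pd⇒least-reach β pd))))

  pd-initial : ∀ {β} → 1 <ℕ t → ℕ→ℚ 0 < β → β ≤ α 1 → IsPd G β (a 1)
  pd-initial 1<t 0<β β≤α₁ =
    pd-between (ℕP.<⇒≤ 1<t) 0<β (ℚP.≤-trans β≤α₁ (ℚP.<⇒≤ (α<1 ℕP.≤-refl 1<t)))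
               (reaches-below β≤α₁) (λ ())

  pd-step : ∀ {β i} → 1 ≤ℕ i → suc i <ℕ t → α i < β → β ≤ α (suc i) → IsPd G β (a (suc i))
  pd-step 1≤i i+1<t αᵢ<β β≤αᵢ₊₁ =
    pd-between (ℕP.<⇒≤ i+1<t)
               (ℚP.<-trans (α-pos 1≤i (ℕP.≤-trans (ℕP.n≤1+n _) (ℕP.<⇒≤ i+1<t))) αᵢ<β)
               (ℚP.≤-trans β≤αᵢ₊₁ (ℚP.<⇒≤ (α<1 (s≤s z≤n) i+1<t)))
               (reaches-below β≤αᵢ₊₁) (λ _ → misses-above αᵢ<β)

  pd-final : ∀ {β i} → 1 ≤ℕ i → suc i ≡ t → α i < β → β ≤ ℕ→ℚ 1 → IsPd G β γ
  pd-final {β} 1≤i refl αᵢ<β β≤1 =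
    subst (IsPd G β) a-last
      (pd-between ℕP.≤-refl (ℚP.<-trans (α-pos 1≤i (ℕP.n≤1+n _)) αᵢ<β) β≤1
                  (subst (Reaches β) (≡-sym a-last) (reaches-γ dom β≤1)) (λ _ → misses-above αᵢ<β))

mainTheorem17 : ∀ {n} (G : Graph n) (γ t : ℕ) (a : ℕ → ℕ)
    → IsDomNumber G γ
    → 1 <ℕ t
    → a 1 ≡ 1
    → a t ≡ γ
    → (∀ i j → 1 ≤ℕ i → i <ℕ j → j ≤ℕ t → a i <ℕ a j)
    → (∀ k → InSpectrum G k ⇔ Σ ℕ (λ i → 1 ≤ℕ i × i ≤ℕ t × a i ≡ k))
    → Σ (ℕ → ℚ) (λ α →
    (∀ i → 1 ≤ℕ i → i ≤ℕ t ∸ 1 → (ℕ→ℚ 0 < α i) × (α i < ℕ→ℚ 1))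
    × (∀ i → 1 ≤ℕ i → i <ℕ t ∸ 1 → α i < α (suc i))
    × (∀ β → ℕ→ℚ 0 < β → β ≤ α 1 → IsPd G β 1)
    × (∀ i → 1 ≤ℕ i → i ≤ℕ t ∸ 2 → ∀ β → α i < β → β ≤ α (suc i) → IsPd G β (a (suc i)))
    × (∀ β → α (t ∸ 1) < β → β ≤ ℕ→ℚ 1 → IsPd G β γ))
mainTheorem17 {n} G γ t a dom 1<t@(s≤s (s≤s z≤n)) a₁ a-last a-mono spec =
  α ,
  (λ i 1≤i i<t → α-pos 1≤i (ℕP.m≤n⇒m≤1+n i<t) , α<1 1≤i (s≤s i<t)) ,
  (λ i 1≤i i+1<t → α-increasing 1≤i (ℕP.m≤n⇒m≤1+n i+1<t)) ,
  (λ β 0<β β≤α₁ → subst (IsPd G β) a₁ (pd-initial 1<t 0<β β≤α₁)) ,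
  (λ i 1≤i i≤t-2 β → pd-step 1≤i (s≤s (s≤s i≤t-2))) ,
  (λ β → pd-final (s≤s z≤n) refl)
  where
    -- The graph is nonempty, since 1 = a_1 belongs to its spectrum.
    vertices-exist : 0 <ℕ n
    vertices-exist = spectrum-bounded G (Equivalence.from (spec 1) (1 , ℕP.≤-refl , ℕP.<⇒≤ 1<t , a₁))

    open Thresholds {{ℕ.>-nonZero vertices-exist}} G γ t a dom a-last a-mono spec
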